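{- Let $U$ be a set with at least two elements and let $\sigma,\pi$ be partitions on $U$. The partition implication $\sigma\Rightarrow\pi$, defined by $\operatorname{dit}(\sigma\Rightarrow\pi)=\operatorname{int}\left(\operatorname{dit}(\sigma)^c\cup\operatorname{dit}(\pi)\right)$, equals the partition obtained from $\pi$ by replacing every block $B\in\pi$ that is contained in some block $C\in\sigma$ by the singletons $\{u\}$, $u\in B$, and leaving every other block of $\pi$ unchanged.
   Context: A partition on $U$ is a set of nonempty, pairwise disjoint subsets of $U$ (blocks) whose union is $U$. For a partition $\pi$, $\operatorname{dit}(\pi)\subseteq U\times U$ is the set of ordered pairs $(u,u')$ with $u,u'$ in different blocks of $\pi$, and $\operatorname{indit}(\pi)=(U\times U)\setminus\operatorname{dit}(\pi)$ is the associated equivalence relation. A partition is determined by its dit set. For $S\subseteq U\times U$, $\overline{S}$ denotes the reflexive–symmetric–transitive closure of $S$ (the smallest equivalence relation on $U$ containing $S$), $S^c=(U\times U)\setminus S$, and $\operatorname{int}(S)=\left(\overline{S^c}\right)^c$; $\operatorname{int}(S)$ is always the dit set of a partition. -}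

module Defs where

open import Level using (0ℓ)
open import Data.Product using (Σ; _×_; _,_; proj₁; proj₂; ∃)
open import Data.Sum using (_⊎_; inj₁; inj₂)
open import Relation.Nullary using (¬_)
open import Relation.Binary.PropositionalEquality using (_≡_; refl; sym; trans; subst)
open import Relation.Binary.Structures using (IsEquivalence)

PairSet : Set → Set₁
PairSet U = U → U → Set

_ᶜ : {U : Set} → PairSet U → PairSet U
(S ᶜ) u v = ¬ S u v

_∪_ : {U : Set} → PairSet U → PairSet U → PairSet U
(S ∪ T) u v = S u v ⊎ T u v

data Closure {U : Set} (S : PairSet U) : U → U → Set where
  base  : ∀ {u v} → S u v → Closure S u v
  rfl   : ∀ {u} → Closure S u u
  symm  : ∀ {u v} → Closure S u v → Closure S v u
  trns  : ∀ {u v w} → Closure S u v → Closure S v w → Closure S u w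

int : {U : Set} → PairSet U → PairSet U
int S = (Closure (S ᶜ)) ᶜ

-- A partition on U, given by its associated equivalence relation indit(π)
-- ("u and u' lie in the same block"); its blocks are the equivalence classes.
record Partition (U : Set) : Set₁ where
  field
    indit   : PairSet U
    isEquiv : IsEquivalence indit
open Partition public

dit : {U : Set} → Partition U → PairSet U
dit π = (indit π) ᶜ

blockOf : {U : Set} → Partition U → U → (U → Set)
blockOf π u v = indit π u v

-- A subset B ⊆ U is contained in some block of σ (every block of σ is blockOf σ c for some c).
ContainedInSomeBlock : {U : Set} → Partition U → (U → Set) → Set
ContainedInSomeBlock {U} σ B = Σ U λ c → ∀ v → B v → blockOf σ c v

dit⇒ : {U : Set} → Partition U → Partition U → PairSet U
dit⇒ σ π = int (((dit σ) ᶜ) ∪ dit π)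

-- The partition obtained from π by replacing each block B of π contained in some block
-- of σ by the singletons {u}, u ∈ B, leaving the other blocks of π unchanged:
-- u, u' share a block iff u = u', or they share a π-block that is not contained in any σ-block.
discretRel : {U : Set} → Partition U → Partition U → PairSet U
discretRel σ π u u' = (u ≡ u') ⊎ (indit π u u' × ¬ ContainedInSomeBlock σ (blockOf π u))

private
  module _ {U : Set} (σ π : Partition U) where
    module E = IsEquivalence (isEquiv π)

    transport : ∀ {u u'} → indit π u u' → ContainedInSomeBlock σ (blockOf π u')
              → ContainedInSomeBlock σ (blockOf π u)
    transport p (c , f) = c , λ v q → f v (E.trans (E.sym p) q)

    dr-refl : ∀ {u} → discretRel σ π u u
    dr-refl = inj₁ refl

    dr-sym : ∀ {u v} → discretRel σ π u v → discretRel σ π v u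
    dr-sym (inj₁ e) = inj₁ (sym e)
    dr-sym (inj₂ (p , n)) = inj₂ (E.sym p , λ h → n (transport p h))

    dr-trans : ∀ {u v w} → discretRel σ π u v → discretRel σ π v w → discretRel σ π u w
    dr-trans (inj₁ refl) q = q
    dr-trans (inj₂ p) (inj₁ refl) = inj₂ p
    dr-trans (inj₂ (p , n)) (inj₂ (q , _)) = inj₂ (E.trans p q , n)

  discretEquiv : {U : Set} (σ π : Partition U) → IsEquivalence (discretRel σ π)
  discretEquiv σ π = record { refl = dr-refl σ π ; sym = dr-sym σ π ; trans = dr-trans σ π }

discretize : {U : Set} → Partition U → Partition U → Partition U
discretize σ π = record { indit = discretRel σ π ; isEquiv = discretEquiv σ π }

-- The pairs excluded from dit(σ ⇒ π) form the equivalence relation generated by the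
-- pairs that π joins and σ separates. Each such pair lies in a π-block not contained
-- in any σ-block, so the discretized partition joins it. Conversely, a π-block not
-- contained in a σ-block has a member z σ-separated from any given member u, and a
-- σ-related pair u, v of the block is then joined through z by a path of length two.
module Submission where

open import Defs
open import Level using (0ℓ)
open import Axiom.ExcludedMiddle using (ExcludedMiddle)
open import Axiom.DoubleNegationElimination using (DoubleNegationElimination; em⇒dne)
open import Data.Product using (Σ; _×_; _,_)
open import Data.Sum using (inj₁; inj₂)
open import Function using (_∘_)
open import Function.Bundles using (_⇔_; mk⇔; Equivalence)
open import Relation.Nullary using (¬_; yes; no)
open import Relation.Nullary.Negation using (contraposition)
open import Relation.Binary.Core using (_⇒_)
open import Relation.Binary.PropositionalEquality using (_≡_; refl)
open import Relation.Binary.Structures using (IsEquivalence)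

module _ {U : Set} where

  Closure-fold : {S R : PairSet U} → IsEquivalence R → S ⇒ R → Closure S ⇒ R
  Closure-fold isEq S⇒R (base s)   = S⇒R s
  Closure-fold isEq S⇒R rfl        = IsEquivalence.refl isEq
  Closure-fold isEq S⇒R (symm c)   = IsEquivalence.sym isEq (Closure-fold isEq S⇒R c)
  Closure-fold isEq S⇒R (trns c d) =
    IsEquivalence.trans isEq (Closure-fold isEq S⇒R c) (Closure-fold isEq S⇒R d)

  Closure-isEquivalence : {S : PairSet U} → IsEquivalence (Closure S)
  Closure-isEquivalence = record { refl = rfl ; sym = symm ; trans = trns }

  Closure-map : {S T : PairSet U} → S ⇒ T → Closure S ⇒ Closure T
  Closure-map S⇒T = Closure-fold Closure-isEquivalence (base ∘ S⇒T)

  JoinedAndSeparated : Partition U → Partition U → PairSet U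
  JoinedAndSeparated σ π u v = indit π u v × dit σ u v

  module _ (σ π : Partition U) where
    private
      module σ = IsEquivalence (isEquiv σ)
      module π = IsEquivalence (isEquiv π)

    joinedAndSeparated⇒discretRel : JoinedAndSeparated σ π ⇒ discretRel σ π
    joinedAndSeparated⇒discretRel {u} {v} (πuv , σ∤uv) =
      inj₂ (πuv , λ (c , block⊆) → σ∤uv (σ.trans (σ.sym (block⊆ u π.refl)) (block⊆ v πuv)))

    joinedAndSeparated⇒¬implies : JoinedAndSeparated σ π ⇒ (((dit σ) ᶜ) ∪ dit π) ᶜ
    joinedAndSeparated⇒¬implies (_   , σ∤uv) (inj₁ ¬σ∤uv) = ¬σ∤uv σ∤uv
    joinedAndSeparated⇒¬implies (πuv , _)    (inj₂ π∤uv)  = π∤uv πuv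

    ¬implies⇒joinedAndSeparated : DoubleNegationElimination 0ℓ →
                                  (((dit σ) ᶜ) ∪ dit π) ᶜ ⇒ JoinedAndSeparated σ π
    ¬implies⇒joinedAndSeparated dne ¬implies =
      dne (¬implies ∘ inj₂) , λ σuv → ¬implies (inj₁ λ σ∤uv → σ∤uv σuv)

    -- If every z in the π-block of u were σ-related to u, that block would lie in σ's block of u.
    uncontained⇒separatedMember : DoubleNegationElimination 0ℓ → ∀ {u} →
                                  ¬ ContainedInSomeBlock σ (blockOf π u) →
                                  Σ U λ z → JoinedAndSeparated σ π u z
    uncontained⇒separatedMember dne {u} uncontained =
      dne λ noSeparated → uncontained (u , λ z πuz → dne λ σ∤uz → noSeparated (z , πuz , σ∤uz))

    discretRel⇒Closure : ExcludedMiddle 0ℓ → discretRel σ π ⇒ Closure (JoinedAndSeparated σ π)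
    discretRel⇒Closure em (inj₁ refl) = rfl
    discretRel⇒Closure em {u} {v} (inj₂ (πuv , uncontained)) with em {indit σ u v}
    ... | no σ∤uv = base (πuv , σ∤uv)
    ... | yes σuv with uncontained⇒separatedMember (em⇒dne em) uncontained
    ...   | z , πuz , σ∤uz =
      trns (base (πuz , σ∤uz))
           (base (π.trans (π.sym πuz) πuv , λ σzv → σ∤uz (σ.trans σuv (σ.sym σzv))))

    Closure-¬implies⇔discretRel : ExcludedMiddle 0ℓ → ∀ {u v} →
                                  Closure ((((dit σ) ᶜ) ∪ dit π) ᶜ) u v ⇔ discretRel σ π u v
    Closure-¬implies⇔discretRel em = mk⇔
      (Closure-fold (isEquiv (discretize σ π))
        (joinedAndSeparated⇒discretRel ∘ ¬implies⇒joinedAndSeparated (em⇒dne em)))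
      (Closure-map joinedAndSeparated⇒¬implies ∘ discretRel⇒Closure em)

mainTheorem1 : ExcludedMiddle 0ℓ → (U : Set) → (Σ U λ a → Σ U λ b → ¬ a ≡ b)
    → (σ π : Partition U)
    → ∀ u u' → dit⇒ σ π u u' ⇔ dit (discretize σ π) u u'
mainTheorem1 em U _ σ π u u' =
  mk⇔ (contraposition from) (contraposition to)
  where open Equivalence (Closure-¬implies⇔discretRel σ π em {u} {u'})
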